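{- The following contraction rules are height-preserving admissible in $\mathsf{G}(\mathbf{KT_n^+})$: for every $n$, if $\Sigma|\Gamma\Rightarrow\Delta,A,A$ has a derivation of height at most $n$ then so does $\Sigma|\Gamma\Rightarrow\Delta,A$; if $\Sigma|A,A,\Gamma\Rightarrow\Delta$ has a derivation of height at most $n$ then so does $\Sigma|A,\Gamma\Rightarrow\Delta$; and if $\Sigma,\Box_iA,\Box_iA|\Gamma\Rightarrow\Delta$ has a derivation of height at most $n$ then so does $\Sigma,\Box_iA|\Gamma\Rightarrow\Delta$.
   Context: Formulas of $\mathcal{L}^1$ over a finite agent set and countable $\mathsf{Prop}$: $A::=p\mid\bot\mid A\wedge A\mid A\vee A\mid A\rightarrow A\mid\neg A\mid\Box_i A$. Outmost-boxed formula: $\Box_jB$; $\Box_i\Gamma=\{\Box_iA:A\in\Gamma\}$. A T-sequent $\Sigma|\Gamma\Rightarrow\Delta$ consists of finite multisets with $\Sigma$ consisting of outmost-boxed formulas. A derivation is a finite tree generated by the rules from initial T-sequents; its height is the maximum length of a branch from root to an initial T-sequent. $\mathsf{G}(\mathbf{KT_n^+})$: initial T-sequents $\Sigma|\Gamma,p\Rightarrow p,\Delta$ and $\Sigma|\bot,\Gamma\Rightarrow\Delta$; logical rules (with $\Sigma$ unchanged): $(R\wedge)$ $\Sigma|\Gamma\Rightarrow\Delta,A_1$ and $\Sigma|\Gamma\Rightarrow\Delta,A_2$ / $\Sigma|\Gamma\Rightarrow\Delta,A_1\wedge A_2$; $(L\wedge)$ $\Sigma|A_1,A_2,\Gamma\Rightarrow\Delta$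 / $\Sigma|A_1\wedge A_2,\Gamma\Rightarrow\Delta$; $(R\vee)$ $\Sigma|\Gamma\Rightarrow\Delta,A_1,A_2$ / $\Sigma|\Gamma\Rightarrow\Delta,A_1\vee A_2$; $(L\vee)$ $\Sigma|A_1,\Gamma\Rightarrow\Delta$ and $\Sigma|A_2,\Gamma\Rightarrow\Delta$ / $\Sigma|A_1\vee A_2,\Gamma\Rightarrow\Delta$; $(R\rightarrow)$ $\Sigma|A_1,\Gamma\Rightarrow\Delta,A_2$ / $\Sigma|\Gamma\Rightarrow\Delta,A_1\rightarrow A_2$; $(L\rightarrow)$ $\Sigma|\Gamma\Rightarrow\Delta,A_1$ and $\Sigma|A_2,\Gamma\Rightarrow\Delta$ / $\Sigma|A_1\rightarrow A_2,\Gamma\Rightarrow\Delta$; $(R\neg)$ $\Sigma|A,\Gamma\Rightarrow\Delta$ / $\Sigma|\Gamma\Rightarrow\Delta,\neg A$; $(L\neg)$ $\Sigma|\Gamma\Rightarrow\Delta,A$ / $\Sigma|\neg A,\Gamma\Rightarrow\Delta$. Modal rules: $(\Box^+_{Kn})$: from $\emptyset|\Gamma\Rightarrow A$ infer $\Sigma,\Box_i\Gamma|\Pi\Rightarrow\Box_iA,\Omega$, where $\Sigma$ contains only formulas $\Box_jB$ with $j\neq i$, $\Pi$ only propositional variables and $\bot$, $\Omega$ only propositional variables, $\bot$, or outmost-boxed formulas; $(\Box^+_{Tn})$: from $\Box_iA,\Sigma|\Gamma,A\Rightarrow\Delta$ infer $\Sigma|\Gamma,\Box_iA\Rightarrow\Delta$.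 -}

module Defs where

open import Data.Nat using (ℕ; suc; _⊔_)
open import Data.Fin using (Fin)
open import Data.List using (List; []; _∷_; _++_; map)
open import Data.List.Relation.Unary.All using (All)
open import Data.List.Relation.Binary.Permutation.Propositional using (_↭_)
open import Data.Product using (Σ; ∃; _×_)
open import Data.Sum using (_⊎_)
open import Relation.Binary.PropositionalEquality using (_≡_; _≢_)

data Fml (m : ℕ) : Set where
  var  : ℕ → Fml m
  ⊥'   : Fml m
  _∧'_ : Fml m → Fml m → Fml m
  _∨'_ : Fml m → Fml m → Fml m
  _⇒'_ : Fml m → Fml m → Fml m
  ¬'_  : Fml m → Fml m
  □    : Fin m → Fml m → Fml m

module _ {m : ℕ} where

  Boxed : Fml m → Set
  Boxed B = Σ (Fin m) λ j → Σ (Fml m) λ C → B ≡ □ j C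

  BoxedNot : Fin m → Fml m → Set
  BoxedNot i B = Σ (Fin m) λ j → Σ (Fml m) λ C → (B ≡ □ j C) × (j ≢ i)

  Atomic : Fml m → Set
  Atomic B = (Σ ℕ λ p → B ≡ var p) ⊎ (B ≡ ⊥')

  AtomicOrBoxed : Fml m → Set
  AtomicOrBoxed B = Atomic B ⊎ Boxed B

-- T-sequent Σ | Γ ⇒ Δ; multisets are lists considered up to permutation (↭)
record TSeq (m : ℕ) : Set where
  constructor _∣_⇒_
  field
    sig : List (Fml m)
    ant : List (Fml m)
    suc' : List (Fml m)

-- Derivations in G(KT_n^+).  Every rule's conclusion is given up to
-- permutation of each multiset component.
data Der {m : ℕ} : TSeq m → Set where
  ax : ∀ {Σ' Γ' Δ'} (Σs Γ Δ : List (Fml m)) (p : ℕ) →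
       All Boxed Σs → Σ' ↭ Σs → Γ' ↭ (var p ∷ Γ) → Δ' ↭ (var p ∷ Δ) →
       Der (Σ' ∣ Γ' ⇒ Δ')
  ax⊥ : ∀ {Σ' Γ' Δ'} (Σs Γ Δ : List (Fml m)) →
       All Boxed Σs → Σ' ↭ Σs → Γ' ↭ (⊥' ∷ Γ) → Δ' ↭ Δ →
       Der (Σ' ∣ Γ' ⇒ Δ')
  R∧ : ∀ {Σ' Γ' Δ'} (Σs Γ Δ : List (Fml m)) (A₁ A₂ : Fml m) →
       Der (Σs ∣ Γ ⇒ (A₁ ∷ Δ)) → Der (Σs ∣ Γ ⇒ (A₂ ∷ Δ)) →
       Σ' ↭ Σs → Γ' ↭ Γ → Δ' ↭ ((A₁ ∧' A₂) ∷ Δ) → Der (Σ' ∣ Γ' ⇒ Δ')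
  L∧ : ∀ {Σ' Γ' Δ'} (Σs Γ Δ : List (Fml m)) (A₁ A₂ : Fml m) →
       Der (Σs ∣ (A₁ ∷ A₂ ∷ Γ) ⇒ Δ) →
       Σ' ↭ Σs → Γ' ↭ ((A₁ ∧' A₂) ∷ Γ) → Δ' ↭ Δ → Der (Σ' ∣ Γ' ⇒ Δ')
  R∨ : ∀ {Σ' Γ' Δ'} (Σs Γ Δ : List (Fml m)) (A₁ A₂ : Fml m) →
       Der (Σs ∣ Γ ⇒ (A₁ ∷ A₂ ∷ Δ)) →
       Σ' ↭ Σs → Γ' ↭ Γ → Δ' ↭ ((A₁ ∨' A₂) ∷ Δ) → Der (Σ' ∣ Γ' ⇒ Δ')
  L∨ : ∀ {Σ' Γ' Δ'} (Σs Γ Δ : List (Fml m)) (A₁ A₂ : Fml m) →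
       Der (Σs ∣ (A₁ ∷ Γ) ⇒ Δ) → Der (Σs ∣ (A₂ ∷ Γ) ⇒ Δ) →
       Σ' ↭ Σs → Γ' ↭ ((A₁ ∨' A₂) ∷ Γ) → Δ' ↭ Δ → Der (Σ' ∣ Γ' ⇒ Δ')
  R→ : ∀ {Σ' Γ' Δ'} (Σs Γ Δ : List (Fml m)) (A₁ A₂ : Fml m) →
       Der (Σs ∣ (A₁ ∷ Γ) ⇒ (A₂ ∷ Δ)) →
       Σ' ↭ Σs → Γ' ↭ Γ → Δ' ↭ ((A₁ ⇒' A₂) ∷ Δ) → Der (Σ' ∣ Γ' ⇒ Δ')
  L→ : ∀ {Σ' Γ' Δ'} (Σs Γ Δ : List (Fml m)) (A₁ A₂ : Fml m) →
       Der (Σs ∣ Γ ⇒ (A₁ ∷ Δ)) → Der (Σs ∣ (A₂ ∷ Γ) ⇒ Δ) →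
       Σ' ↭ Σs → Γ' ↭ ((A₁ ⇒' A₂) ∷ Γ) → Δ' ↭ Δ → Der (Σ' ∣ Γ' ⇒ Δ')
  R¬ : ∀ {Σ' Γ' Δ'} (Σs Γ Δ : List (Fml m)) (A : Fml m) →
       Der (Σs ∣ (A ∷ Γ) ⇒ Δ) →
       Σ' ↭ Σs → Γ' ↭ Γ → Δ' ↭ ((¬' A) ∷ Δ) → Der (Σ' ∣ Γ' ⇒ Δ')
  L¬ : ∀ {Σ' Γ' Δ'} (Σs Γ Δ : List (Fml m)) (A : Fml m) →
       Der (Σs ∣ Γ ⇒ (A ∷ Δ)) →
       Σ' ↭ Σs → Γ' ↭ ((¬' A) ∷ Γ) → Δ' ↭ Δ → Der (Σ' ∣ Γ' ⇒ Δ')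
  □Kn : ∀ {Σ' Γ' Δ'} (i : Fin m) (Σs Γ Π Ω : List (Fml m)) (A : Fml m) →
       Der ([] ∣ Γ ⇒ (A ∷ [])) →
       All (BoxedNot i) Σs → All Atomic Π → All AtomicOrBoxed Ω →
       Σ' ↭ (Σs ++ map (□ i) Γ) → Γ' ↭ Π → Δ' ↭ (□ i A ∷ Ω) →
       Der (Σ' ∣ Γ' ⇒ Δ')
  □Tn : ∀ {Σ' Γ' Δ'} (i : Fin m) (Σs Γ Δ : List (Fml m)) (A : Fml m) →
       Der ((□ i A ∷ Σs) ∣ (A ∷ Γ) ⇒ Δ) →
       Σ' ↭ Σs → Γ' ↭ (□ i A ∷ Γ) → Δ' ↭ Δ → Der (Σ' ∣ Γ' ⇒ Δ')

height : ∀ {m} {S : TSeq m} → Der S → ℕ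
height (ax _ _ _ _ _ _ _ _) = 0
height (ax⊥ _ _ _ _ _ _ _) = 0
height (R∧ _ _ _ _ _ d e _ _ _) = suc (height d ⊔ height e)
height (L∧ _ _ _ _ _ d _ _ _) = suc (height d)
height (R∨ _ _ _ _ _ d _ _ _) = suc (height d)
height (L∨ _ _ _ _ _ d e _ _ _) = suc (height d ⊔ height e)
height (R→ _ _ _ _ _ d _ _ _) = suc (height d)
height (L→ _ _ _ _ _ d e _ _ _) = suc (height d ⊔ height e)
height (R¬ _ _ _ _ d _ _ _) = suc (height d)
height (L¬ _ _ _ _ d _ _ _) = suc (height d)
height (□Kn _ _ _ _ _ _ d _ _ _ _ _ _) = suc (height d)
height (□Tn _ _ _ _ _ d _ _ _) = suc (height d)

DerivH : ∀ {m} → ℕ → TSeq m → Set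
DerivH n S = Σ (Der S) λ d → height d Data.Nat.≤ n

{-# OPTIONS --safe #-}

-- Contraction is proved for all three components at once, by induction on the height bound.
-- If the duplicated formula is principal in the last rule, each premise still contains a copy
-- of it. Every rule except (□⁺_Kn) is height-preserving invertible, so inverting that copy turns
-- each premise into one whose side formulas occur twice; contracting these finitely many
-- formulas at the lower height and reapplying the rule removes the duplicate. Otherwise the
-- contraction is pushed into the premises. For (□⁺_Kn) the only real case is a duplicate □ᵢB
-- in Σ: both copies lie in the part of Σ that is carried along, or both in □ᵢΓ, where they come
-- from two copies of B in the premise's antecedent and are contracted there; one copy in each
-- part is impossible, as the carried part contains no □ᵢ-formulas.

module Submission where

open import Defs
open import Algebra.Bundles using (CommutativeMonoid)
open import Algebra.Structures.Biased using (isCommutativeMonoidˡ)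
import Algebra.Properties.CommutativeSemigroup as CommutativeSemigroupProperties
open import Data.Empty using (⊥-elim)
open import Data.Fin using (Fin)
open import Data.List using (List; []; _∷_; _++_; map)
open import Data.List.Membership.Propositional using (_∈_)
open import Data.List.Membership.Propositional.Properties using (∈-∃++; ∈-++⁻; ∈-++⁺ʳ; ∈-map⁻)
open import Data.List.Relation.Binary.Permutation.Propositional
open import Data.List.Relation.Binary.Permutation.Propositional.Properties
open import Data.List.Relation.Unary.All as All using (All; []; _∷_)
open import Data.List.Relation.Unary.All.Properties using () renaming (++⁺ to All-++⁺)
open import Data.List.Relation.Unary.Any using (here; there)
open import Data.Nat using (ℕ; suc; _≤_; z≤n; s≤s)
open import Data.Nat.Properties using (≤-trans; n≤1+n; m⊔n≤o⇒m≤o; m⊔n≤o⇒n≤o; ⊔-lub)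
open import Data.Product using (∃; ∃₂; _×_; _,_; proj₁; proj₂)
open import Data.Sum using (_⊎_; inj₁; inj₂)
open import Function using (id; _∘_)
open import Relation.Binary.PropositionalEquality using (_≡_; refl)
open import Relation.Nullary using (¬_)

open TSeq

module _ {X : Set} where

  ∈⇒↭∷ : ∀ {x : X} {xs} → x ∈ xs → ∃ λ ys → xs ↭ x ∷ ys
  ∈⇒↭∷ {x} x∈xs with ∈-∃++ x∈xs
  ... | ys , zs , refl = ys ++ zs , shift x ys zs

  ↭∷⇒∈ : ∀ {x : X} {xs ys} → xs ↭ x ∷ ys → x ∈ xs
  ↭∷⇒∈ p = ∈-resp-↭ (↭-sym p) (here refl)

  ∈-dedup : ∀ {x y : X} {xs} → x ∈ y ∷ y ∷ xs → x ∈ y ∷ xs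
  ∈-dedup (here x≡y) = here x≡y
  ∈-dedup (there x∈) = x∈

  ↭-∷-inv : ∀ {a b : X} {l r} → a ∷ l ↭ b ∷ r →
            (a ≡ b × l ↭ r) ⊎ (∃ λ r′ → r ↭ a ∷ r′ × l ↭ b ∷ r′)
  ↭-∷-inv {a} {b} p with ∈-resp-↭ p (here refl)
  ... | here refl = inj₁ (refl , drop-∷ p)
  ... | there a∈r =
    let r′ , q = ∈⇒↭∷ a∈r in
    inj₂ (r′ , q , drop-∷ (↭-trans p (↭-trans (prep b q) (swap b a refl))))

  ↭-∷-++-inv : ∀ {x : X} {l} xs {ys} → x ∷ l ↭ xs ++ ys →
               (∃ λ xs′ → xs ↭ x ∷ xs′ × l ↭ xs′ ++ ys) ⊎
               (∃ λ ys′ → ys ↭ x ∷ ys′ × l ↭ xs ++ ys′)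
  ↭-∷-++-inv {x} xs {ys} p with ∈-++⁻ xs (∈-resp-↭ p (here refl))
  ... | inj₁ x∈xs =
    let xs′ , q = ∈⇒↭∷ x∈xs in
    inj₁ (xs′ , q , drop-∷ (↭-trans p (++⁺ʳ ys q)))
  ... | inj₂ x∈ys =
    let ys′ , q = ∈⇒↭∷ x∈ys in
    inj₂ (ys′ , q , drop-∷ (↭-trans p (↭-trans (++⁺ˡ xs q) (shift x xs ys′))))

  ↭-∷∷-++-inv : ∀ {a : X} {l} xs {ys} → a ∷ a ∷ l ↭ xs ++ ys →
                (∃ λ xs′ → xs ↭ a ∷ a ∷ xs′ × l ↭ xs′ ++ ys) ⊎
                (∃ λ ys′ → ys ↭ a ∷ a ∷ ys′ × l ↭ xs ++ ys′) ⊎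
                (a ∈ xs × a ∈ ys)
  ↭-∷∷-++-inv {a} xs p with ↭-∷-++-inv xs p
  ... | inj₁ (xs₁ , q₁ , p₁) with ↭-∷-++-inv xs₁ p₁
  ...   | inj₁ (xs₂ , q₂ , p₂) = inj₁ (xs₂ , ↭-trans q₁ (prep a q₂) , p₂)
  ...   | inj₂ (_ , q₂ , _) = inj₂ (inj₂ (↭∷⇒∈ q₁ , ↭∷⇒∈ q₂))
  ↭-∷∷-++-inv {a} xs p | inj₂ (ys₁ , q₁ , p₁) with ↭-∷-++-inv xs p₁
  ...   | inj₁ (_ , q₂ , _) = inj₂ (inj₂ (↭∷⇒∈ q₂ , ↭∷⇒∈ q₁))
  ...   | inj₂ (ys₂ , q₂ , p₂) = inj₂ (inj₁ (ys₂ , ↭-trans q₁ (prep a q₂) , p₂))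

  map-↭-∷-inv : ∀ {Y : Set} (f : X → Y) → ∀ {xs y ys} → map f xs ↭ y ∷ ys →
                ∃₂ λ x xs′ → y ≡ f x × xs ↭ x ∷ xs′ × ys ↭ map f xs′
  map-↭-∷-inv f p with ∈-map⁻ f (∈-resp-↭ (↭-sym p) (here refl))
  ... | x , x∈xs , refl =
    let xs′ , q = ∈⇒↭∷ x∈xs in
    x , xs′ , refl , q , drop-∷ (↭-trans (↭-sym p) (map⁺ f q))

  All-diagonal : ∀ {P : X → X → Set} {xs} →
                 All (λ x → All (P x) xs) xs → All (λ x → P x x) xs
  All-diagonal pxs = All.tabulate (λ x∈ → All.lookup (All.lookup pxs x∈) x∈)

module _ {m : ℕ} where

  infixr 6 _⊕_
  infix 4 _≋_

  _⊕_ : TSeq m → TSeq m → TSeq m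
  s ⊕ s′ = (sig s ++ sig s′) ∣ (ant s ++ ant s′) ⇒ (suc' s ++ suc' s′)

  ε : TSeq m
  ε = [] ∣ [] ⇒ []

  record _≋_ (s s′ : TSeq m) : Set where
    constructor ⟨_,_,_⟩
    field
      sig-↭ : sig s ↭ sig s′
      ant-↭ : ant s ↭ ant s′
      suc-↭ : suc' s ↭ suc' s′

  ⊕-commutativeMonoid : CommutativeMonoid _ _
  ⊕-commutativeMonoid = record
    { Carrier = TSeq m
    ; _≈_ = _≋_
    ; _∙_ = _⊕_
    ; ε = ε
    ; isCommutativeMonoid = isCommutativeMonoidˡ record
      { isSemigroup = record
        { isMagma = record
          { isEquivalence = record
            { refl = ⟨ ↭-refl , ↭-refl , ↭-refl ⟩
            ; sym = λ { ⟨ p , q , r ⟩ → ⟨ ↭-sym p , ↭-sym q , ↭-sym r ⟩ }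
            ; trans = λ { ⟨ p , q , r ⟩ ⟨ p′ , q′ , r′ ⟩ →
                          ⟨ ↭-trans p p′ , ↭-trans q q′ , ↭-trans r r′ ⟩ }
            }
          ; ∙-cong = λ { ⟨ p , q , r ⟩ ⟨ p′ , q′ , r′ ⟩ →
                         ⟨ ++⁺ p p′ , ++⁺ q q′ , ++⁺ r r′ ⟩ }
          }
        ; assoc = λ s s′ s″ → ⟨ ++-assoc (sig s) (sig s′) (sig s″)
                              , ++-assoc (ant s) (ant s′) (ant s″)
                              , ++-assoc (suc' s) (suc' s′) (suc' s″) ⟩
        }
      ; identityˡ = λ _ → ⟨ ↭-refl , ↭-refl , ↭-refl ⟩
      ; comm = λ s s′ → ⟨ ++-comm (sig s) (sig s′)
                         , ++-comm (ant s) (ant s′)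
                         , ++-comm (suc' s) (suc' s′) ⟩
      }
    }

  open CommutativeMonoid ⊕-commutativeMonoid
    using ()
    renaming ( refl to ≋-refl; sym to ≋-sym; trans to ≋-trans
             ; assoc to ⊕-assoc; ∙-congˡ to ⊕-congˡ; ∙-congʳ to ⊕-congʳ )
  open CommutativeSemigroupProperties (CommutativeMonoid.commutativeSemigroup ⊕-commutativeMonoid)
    using (interchange; x∙yz≈y∙xz; x∙yz≈yx∙z)

  data Component : Set where
    boxes antecedent succedent : Component

  single : Component → Fml m → TSeq m
  single boxes      A = (A ∷ []) ∣ [] ⇒ []
  single antecedent A = [] ∣ (A ∷ []) ⇒ []
  single succedent  A = [] ∣ [] ⇒ (A ∷ [])

  single-⊕-inv : ∀ c c′ {A A′ s s′} → single c A ⊕ s ≋ single c′ A′ ⊕ s′ →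
                 (c ≡ c′ × A ≡ A′ × s ≋ s′) ⊎
                 (∃ λ s″ → s ≋ single c′ A′ ⊕ s″ × s′ ≋ single c A ⊕ s″)
  single-⊕-inv boxes boxes {s = s} ⟨ eΣ , eΓ , eΔ ⟩ with ↭-∷-inv eΣ
  ... | inj₁ (refl , e) = inj₁ (refl , refl , ⟨ e , eΓ , eΔ ⟩)
  ... | inj₂ (S , e , e′) =
    inj₂ (S ∣ ant s ⇒ suc' s ,
          ⟨ e′ , ↭-refl , ↭-refl ⟩ , ⟨ e , ↭-sym eΓ , ↭-sym eΔ ⟩)
  single-⊕-inv antecedent antecedent {s = s} ⟨ eΣ , eΓ , eΔ ⟩ with ↭-∷-inv eΓ
  ... | inj₁ (refl , e) = inj₁ (refl , refl , ⟨ eΣ , e , eΔ ⟩)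
  ... | inj₂ (G , e , e′) =
    inj₂ (sig s ∣ G ⇒ suc' s ,
          ⟨ ↭-refl , e′ , ↭-refl ⟩ , ⟨ ↭-sym eΣ , e , ↭-sym eΔ ⟩)
  single-⊕-inv succedent succedent {s = s} ⟨ eΣ , eΓ , eΔ ⟩ with ↭-∷-inv eΔ
  ... | inj₁ (refl , e) = inj₁ (refl , refl , ⟨ eΣ , eΓ , e ⟩)
  ... | inj₂ (D , e , e′) =
    inj₂ (sig s ∣ ant s ⇒ D ,
          ⟨ ↭-refl , ↭-refl , e′ ⟩ , ⟨ ↭-sym eΣ , ↭-sym eΓ , e ⟩)
  single-⊕-inv boxes antecedent {s = s} {s′} ⟨ eΣ , eΓ , eΔ ⟩ =
    inj₂ (sig s ∣ ant s′ ⇒ suc' s ,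
          ⟨ ↭-refl , eΓ , ↭-refl ⟩ , ⟨ ↭-sym eΣ , ↭-refl , ↭-sym eΔ ⟩)
  single-⊕-inv boxes succedent {s = s} {s′} ⟨ eΣ , eΓ , eΔ ⟩ =
    inj₂ (sig s ∣ ant s ⇒ suc' s′ ,
          ⟨ ↭-refl , ↭-refl , eΔ ⟩ , ⟨ ↭-sym eΣ , ↭-sym eΓ , ↭-refl ⟩)
  single-⊕-inv antecedent boxes {s = s} {s′} ⟨ eΣ , eΓ , eΔ ⟩ =
    inj₂ (sig s′ ∣ ant s ⇒ suc' s ,
          ⟨ eΣ , ↭-refl , ↭-refl ⟩ , ⟨ ↭-refl , ↭-sym eΓ , ↭-sym eΔ ⟩)
  single-⊕-inv antecedent succedent {s = s} {s′} ⟨ eΣ , eΓ , eΔ ⟩ =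
    inj₂ (sig s ∣ ant s ⇒ suc' s′ ,
          ⟨ ↭-refl , ↭-refl , eΔ ⟩ , ⟨ ↭-sym eΣ , ↭-sym eΓ , ↭-refl ⟩)
  single-⊕-inv succedent boxes {s = s} {s′} ⟨ eΣ , eΓ , eΔ ⟩ =
    inj₂ (sig s′ ∣ ant s ⇒ suc' s ,
          ⟨ eΣ , ↭-refl , ↭-refl ⟩ , ⟨ ↭-refl , ↭-sym eΓ , ↭-sym eΔ ⟩)
  single-⊕-inv succedent antecedent {s = s} {s′} ⟨ eΣ , eΓ , eΔ ⟩ =
    inj₂ (sig s ∣ ant s′ ⇒ suc' s ,
          ⟨ ↭-refl , eΓ , ↭-refl ⟩ , ⟨ ↭-sym eΣ , ↭-refl , ↭-sym eΔ ⟩)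

  data Axiom (Γ Δ : List (Fml m)) : Set where
    identity : ∀ p → var p ∈ Γ → var p ∈ Δ → Axiom Γ Δ
    falsum   : ⊥' ∈ Γ → Axiom Γ Δ

  Axiom-mono : ∀ {Γ Γ′ Δ Δ′} →
               (∀ {x} → Atomic x → x ∈ Γ → x ∈ Γ′) →
               (∀ {x} → Atomic x → x ∈ Δ → x ∈ Δ′) →
               Axiom Γ Δ → Axiom Γ′ Δ′
  Axiom-mono f g (identity p p∈Γ p∈Δ) =
    identity p (f (inj₁ (p , refl)) p∈Γ) (g (inj₁ (p , refl)) p∈Δ)
  Axiom-mono f g (falsum ⊥∈Γ) = falsum (f (inj₂ refl) ⊥∈Γ)

  ∈-∷-nonatomic⁻ : ∀ {B x} {xs : List (Fml m)} →
                   ¬ Atomic B → Atomic x → x ∈ B ∷ xs → x ∈ xs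
  ∈-∷-nonatomic⁻ ¬atomic atomic (here refl) = ⊥-elim (¬atomic atomic)
  ∈-∷-nonatomic⁻ _      _      (there x∈xs) = x∈xs

  Initial : TSeq m → Set
  Initial s = All Boxed (sig s) × Axiom (ant s) (suc' s)

  fromInitial : ∀ {n s} → Initial s → DerivH n s
  fromInitial (boxed , identity p p∈Γ p∈Δ) =
    ax _ _ _ p boxed ↭-refl (proj₂ (∈⇒↭∷ p∈Γ)) (proj₂ (∈⇒↭∷ p∈Δ)) , z≤n
  fromInitial (boxed , falsum ⊥∈Γ) =
    ax⊥ _ _ _ boxed ↭-refl (proj₂ (∈⇒↭∷ ⊥∈Γ)) ↭-refl , z≤n

  Initial-resp-≋ : ∀ {s s′} → s ≋ s′ → Initial s → Initial s′
  Initial-resp-≋ ⟨ eΣ , eΓ , eΔ ⟩ (boxed , axiom) =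
    All-resp-↭ eΣ boxed , Axiom-mono (λ _ → ∈-resp-↭ eΓ) (λ _ → ∈-resp-↭ eΔ) axiom

  Initial-weaken : ∀ {t s} → All Boxed (sig t) → Initial s → Initial (t ⊕ s)
  Initial-weaken {t} boxedᵗ (boxed , axiom) =
    All-++⁺ boxedᵗ boxed ,
    Axiom-mono (λ _ → ∈-++⁺ʳ (ant t)) (λ _ → ∈-++⁺ʳ (suc' t)) axiom

  -- Π is the whole antecedent and Ω the succedent without □ᵢA, so neither is stored.
  record KnInference (k : ℕ) (s : TSeq m) : Set where
    field
      agent             : Fin m
      others            : List (Fml m)
      context           : List (Fml m)
      goal              : Fml m
      premise           : DerivH k ([] ∣ context ⇒ (goal ∷ []))
      others-boxedNot   : All (BoxedNot agent) others
      sig↭              : sig s ↭ others ++ map (□ agent) context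
      ant-atomic        : All Atomic (ant s)
      goal∈suc          : □ agent goal ∈ suc' s
      suc-atomicOrBoxed : All AtomicOrBoxed (suc' s)

  open KnInference

  fromKn : ∀ {k s} → KnInference k s → DerivH (suc k) s
  fromKn κ =
    □Kn (agent κ) (others κ) (context κ) _ Ω (goal κ) (proj₁ (premise κ))
        (others-boxedNot κ) (ant-atomic κ) (All.tail (All-resp-↭ eΔ (suc-atomicOrBoxed κ)))
        (sig↭ κ) ↭-refl eΔ
    , s≤s (proj₂ (premise κ))
    where
      Ω  = proj₁ (∈⇒↭∷ (goal∈suc κ))
      eΔ = proj₂ (∈⇒↭∷ (goal∈suc κ))

  KnInference-resp-≋ : ∀ {k s s′} → s ≋ s′ → KnInference k s → KnInference k s′
  KnInference-resp-≋ ⟨ eΣ , eΓ , eΔ ⟩ κ = record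
    { K hiding (sig↭; ant-atomic; goal∈suc; suc-atomicOrBoxed)
    ; sig↭              = ↭-trans (↭-sym eΣ) (sig↭ κ)
    ; ant-atomic        = All-resp-↭ eΓ (ant-atomic κ)
    ; goal∈suc          = ∈-resp-↭ eΔ (goal∈suc κ)
    ; suc-atomicOrBoxed = All-resp-↭ eΔ (suc-atomicOrBoxed κ)
    }
    where module K = KnInference κ

  -- The rules other than (□⁺_Kn) share their context: r concludes single c A ⊕ s from the
  -- premises t ⊕ s, t ∈ premises r.
  data Rule : Component → Fml m → Set where
    conjL : ∀ {a b} → Rule antecedent (a ∧' b)
    disjL : ∀ {a b} → Rule antecedent (a ∨' b)
    implL : ∀ {a b} → Rule antecedent (a ⇒' b)
    negL  : ∀ {a}   → Rule antecedent (¬' a)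
    boxT  : ∀ {i a} → Rule antecedent (□ i a)
    conjR : ∀ {a b} → Rule succedent (a ∧' b)
    disjR : ∀ {a b} → Rule succedent (a ∨' b)
    implR : ∀ {a b} → Rule succedent (a ⇒' b)
    negR  : ∀ {a}   → Rule succedent (¬' a)

  premises : ∀ {c A} → Rule c A → List (TSeq m)
  premises (conjL {a} {b}) = single antecedent a ⊕ single antecedent b ∷ []
  premises (disjL {a} {b}) = single antecedent a ∷ single antecedent b ∷ []
  premises (implL {a} {b}) = single succedent a ∷ single antecedent b ∷ []
  premises (negL {a})      = single succedent a ∷ []
  premises (boxT {i} {a})  = single boxes (□ i a) ⊕ single antecedent a ∷ []
  premises (conjR {a} {b}) = single succedent a ∷ single succedent b ∷ []
  premises (disjR {a} {b}) = single succedent a ⊕ single succedent b ∷ []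
  premises (implR {a} {b}) = single antecedent a ⊕ single succedent b ∷ []
  premises (negR {a})      = single antecedent a ∷ []

  Premises : ∀ {c A} → ℕ → Rule c A → TSeq m → Set
  Premises k r s = All (λ t → DerivH k (t ⊕ s)) (premises r)

  infer : ∀ {k c A s s′} (r : Rule c A) →
          s ≋ single c A ⊕ s′ → Premises k r s′ → DerivH (suc k) s
  infer conjL ⟨ eΣ , eΓ , eΔ ⟩ ((d , h) ∷ []) = L∧ _ _ _ _ _ d eΣ eΓ eΔ , s≤s h
  infer disjL ⟨ eΣ , eΓ , eΔ ⟩ ((d , h) ∷ (d′ , h′) ∷ []) =
    L∨ _ _ _ _ _ d d′ eΣ eΓ eΔ , s≤s (⊔-lub h h′)
  infer implL ⟨ eΣ , eΓ , eΔ ⟩ ((d , h) ∷ (d′ , h′) ∷ []) =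
    L→ _ _ _ _ _ d d′ eΣ eΓ eΔ , s≤s (⊔-lub h h′)
  infer negL  ⟨ eΣ , eΓ , eΔ ⟩ ((d , h) ∷ []) = L¬ _ _ _ _ d eΣ eΓ eΔ , s≤s h
  infer boxT  ⟨ eΣ , eΓ , eΔ ⟩ ((d , h) ∷ []) = □Tn _ _ _ _ _ d eΣ eΓ eΔ , s≤s h
  infer conjR ⟨ eΣ , eΓ , eΔ ⟩ ((d , h) ∷ (d′ , h′) ∷ []) =
    R∧ _ _ _ _ _ d d′ eΣ eΓ eΔ , s≤s (⊔-lub h h′)
  infer disjR ⟨ eΣ , eΓ , eΔ ⟩ ((d , h) ∷ []) = R∨ _ _ _ _ _ d eΣ eΓ eΔ , s≤s h
  infer implR ⟨ eΣ , eΓ , eΔ ⟩ ((d , h) ∷ []) = R→ _ _ _ _ _ d eΣ eΓ eΔ , s≤s h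
  infer negR  ⟨ eΣ , eΓ , eΔ ⟩ ((d , h) ∷ []) = R¬ _ _ _ _ d eΣ eΓ eΔ , s≤s h

  Rule-unique : ∀ {c A} (r r′ : Rule c A) → r ≡ r′
  Rule-unique conjL conjL = refl
  Rule-unique disjL disjL = refl
  Rule-unique implL implL = refl
  Rule-unique negL  negL  = refl
  Rule-unique boxT  boxT  = refl
  Rule-unique conjR conjR = refl
  Rule-unique disjR disjR = refl
  Rule-unique implR implR = refl
  Rule-unique negR  negR  = refl

  antecedent-rule-nonatomic : ∀ {A} → Rule antecedent A → ¬ Atomic A
  antecedent-rule-nonatomic () (inj₁ (_ , refl))
  antecedent-rule-nonatomic () (inj₂ refl)

  succedent-rule-not-atomicOrBoxed : ∀ {A} → Rule succedent A → ¬ AtomicOrBoxed A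
  succedent-rule-not-atomicOrBoxed () (inj₁ (inj₁ (_ , refl)))
  succedent-rule-not-atomicOrBoxed () (inj₁ (inj₂ refl))
  succedent-rule-not-atomicOrBoxed () (inj₂ (_ , _ , refl))

  premises-sig-boxed : ∀ {c A} (r : Rule c A) → All (λ t → All Boxed (sig t)) (premises r)
  premises-sig-boxed conjL = [] ∷ []
  premises-sig-boxed disjL = [] ∷ [] ∷ []
  premises-sig-boxed implL = [] ∷ [] ∷ []
  premises-sig-boxed negL  = [] ∷ []
  premises-sig-boxed boxT  = ((_ , _ , refl) ∷ []) ∷ []
  premises-sig-boxed conjR = [] ∷ [] ∷ []
  premises-sig-boxed disjR = [] ∷ []
  premises-sig-boxed implR = [] ∷ []
  premises-sig-boxed negR  = [] ∷ []

  data LastRule : ℕ → TSeq m → Set where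
    initial : ∀ {n s} → Initial s → LastRule n s
    kn      : ∀ {k s} → KnInference k s → LastRule (suc k) s
    rule    : ∀ {k s c A} (r : Rule c A) (s′ : TSeq m) →
              s ≋ single c A ⊕ s′ → Premises k r s′ → LastRule (suc k) s

  lastRule : ∀ {n s} → DerivH n s → LastRule n s
  lastRule (ax _ _ _ p boxed eΣ eΓ eΔ , _) =
    initial (All-resp-↭ (↭-sym eΣ) boxed , identity p (↭∷⇒∈ eΓ) (↭∷⇒∈ eΔ))
  lastRule (ax⊥ _ _ _ boxed eΣ eΓ eΔ , _) =
    initial (All-resp-↭ (↭-sym eΣ) boxed , falsum (↭∷⇒∈ eΓ))
  lastRule (□Kn i Σs Γ _ _ A d boxedNot atomic atomicOrBoxed eΣ eΓ eΔ , s≤s h) = kn record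
    { agent             = i
    ; others            = Σs
    ; context           = Γ
    ; goal              = A
    ; premise           = d , h
    ; others-boxedNot   = boxedNot
    ; sig↭              = eΣ
    ; ant-atomic        = All-resp-↭ (↭-sym eΓ) atomic
    ; goal∈suc          = ↭∷⇒∈ eΔ
    ; suc-atomicOrBoxed = All-resp-↭ (↭-sym eΔ) (inj₂ (i , A , refl) ∷ atomicOrBoxed)
    }
  lastRule (L∧ Σs Γ Δ _ _ d eΣ eΓ eΔ , s≤s h) =
    rule conjL (Σs ∣ Γ ⇒ Δ) ⟨ eΣ , eΓ , eΔ ⟩ ((d , h) ∷ [])
  lastRule (L∨ Σs Γ Δ _ _ d d′ eΣ eΓ eΔ , s≤s h) =
    rule disjL (Σs ∣ Γ ⇒ Δ) ⟨ eΣ , eΓ , eΔ ⟩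
      ((d , m⊔n≤o⇒m≤o _ _ h) ∷ (d′ , m⊔n≤o⇒n≤o _ _ h) ∷ [])
  lastRule (L→ Σs Γ Δ _ _ d d′ eΣ eΓ eΔ , s≤s h) =
    rule implL (Σs ∣ Γ ⇒ Δ) ⟨ eΣ , eΓ , eΔ ⟩
      ((d , m⊔n≤o⇒m≤o _ _ h) ∷ (d′ , m⊔n≤o⇒n≤o _ _ h) ∷ [])
  lastRule (L¬ Σs Γ Δ _ d eΣ eΓ eΔ , s≤s h) =
    rule negL (Σs ∣ Γ ⇒ Δ) ⟨ eΣ , eΓ , eΔ ⟩ ((d , h) ∷ [])
  lastRule (□Tn _ Σs Γ Δ _ d eΣ eΓ eΔ , s≤s h) =
    rule boxT (Σs ∣ Γ ⇒ Δ) ⟨ eΣ , eΓ , eΔ ⟩ ((d , h) ∷ [])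
  lastRule (R∧ Σs Γ Δ _ _ d d′ eΣ eΓ eΔ , s≤s h) =
    rule conjR (Σs ∣ Γ ⇒ Δ) ⟨ eΣ , eΓ , eΔ ⟩
      ((d , m⊔n≤o⇒m≤o _ _ h) ∷ (d′ , m⊔n≤o⇒n≤o _ _ h) ∷ [])
  lastRule (R∨ Σs Γ Δ _ _ d eΣ eΓ eΔ , s≤s h) =
    rule disjR (Σs ∣ Γ ⇒ Δ) ⟨ eΣ , eΓ , eΔ ⟩ ((d , h) ∷ [])
  lastRule (R→ Σs Γ Δ _ _ d eΣ eΓ eΔ , s≤s h) =
    rule implR (Σs ∣ Γ ⇒ Δ) ⟨ eΣ , eΓ , eΔ ⟩ ((d , h) ∷ [])
  lastRule (R¬ Σs Γ Δ _ d eΣ eΓ eΔ , s≤s h) =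
    rule negR (Σs ∣ Γ ⇒ Δ) ⟨ eΣ , eΓ , eΔ ⟩ ((d , h) ∷ [])

  DerivH-resp-≋ : ∀ {n s s′} → s ≋ s′ → DerivH n s → DerivH n s′
  DerivH-resp-≋ e d with lastRule d
  ... | initial ini        = fromInitial (Initial-resp-≋ e ini)
  ... | kn κ               = fromKn (KnInference-resp-≋ e κ)
  ... | rule r _ e′ above  = infer r (≋-trans (≋-sym e) e′) above

  DerivH-mono : ∀ {k n} {s : TSeq m} → k ≤ n → DerivH k s → DerivH n s
  DerivH-mono k≤n (d , h) = d , ≤-trans h k≤n

  Premises-resp-≋ : ∀ {k c A s s′} {r : Rule c A} →
                    s ≋ s′ → Premises k r s → Premises k r s′
  Premises-resp-≋ e = All.map (λ {t} → DerivH-resp-≋ (⊕-congˡ {t} e))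

  Replaceable : ℕ → TSeq m → TSeq m → Set
  Replaceable k x y = ∀ w → DerivH k (x ⊕ w) → DerivH k (y ⊕ w)

  replace-in-premises : ∀ {k c A x y s} (r : Rule c A) → Replaceable k x y →
                        Premises k r (x ⊕ s) → DerivH (suc k) (y ⊕ single c A ⊕ s)
  replace-in-premises {k} {c} {A} {x} {y} {s} r replace above =
    infer r (x∙yz≈y∙xz y (single c A) s) (All.map (λ {t} → replace-in t) above)
    where
      replace-in : ∀ t → DerivH k (t ⊕ x ⊕ s) → DerivH k (t ⊕ y ⊕ s)
      replace-in t d =
        DerivH-resp-≋ (x∙yz≈y∙xz y t s)
          (replace (t ⊕ s) (DerivH-resp-≋ (x∙yz≈y∙xz t x s) d))

  Kn-excludes-rule : ∀ {k c A w} → Rule c A → ¬ KnInference k (single c A ⊕ w)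
  Kn-excludes-rule {c = antecedent} r κ =
    antecedent-rule-nonatomic r (All.head (ant-atomic κ))
  Kn-excludes-rule {c = succedent}  r κ =
    succedent-rule-not-atomicOrBoxed r (All.head (suc-atomicOrBoxed κ))

  Initial-drop-principal : ∀ {c A w} → Rule c A → Initial (single c A ⊕ w) → Initial w
  Initial-drop-principal {antecedent} r (boxed , axiom) =
    boxed , Axiom-mono (∈-∷-nonatomic⁻ (antecedent-rule-nonatomic r)) (λ _ → id) axiom
  Initial-drop-principal {succedent} r (boxed , axiom) =
    boxed ,
    Axiom-mono (λ _ → id) (∈-∷-nonatomic⁻ (succedent-rule-not-atomicOrBoxed r ∘ inj₁)) axiom

  invert : ∀ n {c A} (r : Rule c A) w → DerivH n (single c A ⊕ w) → Premises n r w
  invert n {c} r w d with lastRule d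
  ... | initial ini =
    All.map (λ boxedᵗ → fromInitial (Initial-weaken boxedᵗ (Initial-drop-principal r ini)))
            (premises-sig-boxed r)
  ... | kn κ = ⊥-elim (Kn-excludes-rule r κ)
  ... | rule {c = c′} r′ s′ e above with single-⊕-inv c c′ e
  ...   | inj₂ (s″ , e₁ , e₂) =
    All.tabulate λ t∈ →
      DerivH-resp-≋ (⊕-congˡ (≋-sym e₁))
        (replace-in-premises r′ (λ u d′ → All.lookup (invert _ r u d′) t∈)
                                (Premises-resp-≋ e₂ above))
  ...   | inj₁ (refl , refl , e′) with Rule-unique r r′
  ...     | refl = All.map (DerivH-mono (n≤1+n _)) (Premises-resp-≋ (≋-sym e′) above)

  Contractible : ℕ → TSeq m → Set
  Contractible k a = Replaceable k (a ⊕ a) a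

  ⊕-contractible : ∀ {k a b} → Contractible k a → Contractible k b → Contractible k (a ⊕ b)
  ⊕-contractible {a = a} {b} contractᵃ contractᵇ w d =
    DerivH-resp-≋ (x∙yz≈yx∙z b a w)
      (contractᵇ (a ⊕ w) (DerivH-resp-≋ (x∙yz≈y∙xz a (b ⊕ b) w)
        (contractᵃ ((b ⊕ b) ⊕ w) (DerivH-resp-≋ regroup d))))
    where
      regroup : ((a ⊕ b) ⊕ (a ⊕ b)) ⊕ w ≋ (a ⊕ a) ⊕ (b ⊕ b) ⊕ w
      regroup = ≋-trans (⊕-congʳ (interchange a b a b)) (⊕-assoc (a ⊕ a) (b ⊕ b) w)

  Initial-contract : ∀ c {A w} →
                     Initial ((single c A ⊕ single c A) ⊕ w) → Initial (single c A ⊕ w)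
  Initial-contract boxes      (boxed , axiom) = All.tail boxed , axiom
  Initial-contract antecedent (boxed , axiom) =
    boxed , Axiom-mono (λ _ → ∈-dedup) (λ _ → id) axiom
  Initial-contract succedent  (boxed , axiom) =
    boxed , Axiom-mono (λ _ → id) (λ _ → ∈-dedup) axiom

  BoxedNot-∉-map : ∀ {i B} {xs ys : List (Fml m)} →
                   All (BoxedNot i) xs → B ∈ xs → ¬ B ∈ map (□ i) ys
  BoxedNot-∉-map {i} boxedNot B∈xs B∈ys with All.lookup boxedNot B∈xs | ∈-map⁻ (□ i) B∈ys
  ... | _ , _ , refl , j≢i | _ , _ , refl = j≢i refl

  -- Binding the agent to a variable is what allows B to be unified with □ i C below.
  Kn-contract-boxes : ∀ {k B w} → (∀ C → Contractible k (single antecedent C)) →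
                      KnInference k ((B ∷ B ∷ sig w) ∣ ant w ⇒ suc' w) →
                      KnInference k ((B ∷ sig w) ∣ ant w ⇒ suc' w)
  Kn-contract-boxes {B = B} contract κ@record { agent = i }
    with ↭-∷∷-++-inv (others κ) (sig↭ κ)
  ... | inj₁ (Σs , eΣs , eS) = record
    { K hiding (others; others-boxedNot; sig↭)
    ; others          = B ∷ Σs
    ; others-boxedNot = All.tail (All-resp-↭ eΣs (others-boxedNot κ))
    ; sig↭            = prep B eS
    }
    where module K = KnInference κ
  ... | inj₂ (inj₂ (B∈others , B∈boxedContext)) =
    ⊥-elim (BoxedNot-∉-map (others-boxedNot κ) B∈others B∈boxedContext)
  ... | inj₂ (inj₁ (M , eM , eS)) with map-↭-∷-inv (□ i) eM
  ...   | C , Γ₁ , refl , eΓ₁ , eM₁ with map-↭-∷-inv (□ i) (↭-sym eM₁)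
  ...     | .C , Γ₂ , refl , eΓ₂ , eM₂ = record
    { K hiding (context; premise; sig↭)
    ; context = C ∷ Γ₂
    ; premise = contract C ([] ∣ Γ₂ ⇒ (goal κ ∷ []))
                  (DerivH-resp-≋ ⟨ ↭-refl , ↭-trans eΓ₁ (prep C eΓ₂) , ↭-refl ⟩
                                 (premise κ))
    ; sig↭    = ↭-trans (prep B (↭-trans eS (++⁺ˡ (others κ) eM₂)))
                        (↭-sym (shift B (others κ) (map (□ i) Γ₂)))
    }
    where module K = KnInference κ

  Kn-contract : ∀ c {k A w} → (∀ C → Contractible k (single antecedent C)) →
                KnInference k ((single c A ⊕ single c A) ⊕ w) → KnInference k (single c A ⊕ w)
  Kn-contract boxes      contract κ = Kn-contract-boxes contract κ
  Kn-contract antecedent _        κ = record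
    { K hiding (ant-atomic)
    ; ant-atomic = All.tail (ant-atomic κ)
    }
    where module K = KnInference κ
  Kn-contract succedent  _        κ = record
    { K hiding (goal∈suc; suc-atomicOrBoxed)
    ; goal∈suc          = ∈-dedup (goal∈suc κ)
    ; suc-atomicOrBoxed = All.tail (suc-atomicOrBoxed κ)
    }
    where module K = KnInference κ

  locate-duplicate : ∀ c c′ {A A′ w s′} →
                     (single c A ⊕ single c A) ⊕ w ≋ single c′ A′ ⊕ s′ →
                     (c ≡ c′ × A ≡ A′ × s′ ≋ single c A ⊕ w) ⊎
                     (∃ λ s″ → s′ ≋ (single c A ⊕ single c A) ⊕ s″ ×
                               w ≋ single c′ A′ ⊕ s″)
  locate-duplicate c c′ {A} {A′} {w} e
    with single-⊕-inv c c′ {A} {A′} (≋-trans (≋-sym (⊕-assoc (single c A) (single c A) w)) e)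
  ... | inj₁ (refl , refl , e₁) = inj₁ (refl , refl , ≋-sym e₁)
  ... | inj₂ (u , e₁ , e₂) with single-⊕-inv c c′ {A} {A′} e₁
  ...   | inj₁ (refl , refl , e₃) = inj₁ (refl , refl , ≋-trans e₂ (⊕-congˡ (≋-sym e₃)))
  ...   | inj₂ (s″ , e₃ , e₄) =
    inj₂ ( s″
         , ≋-trans e₂ (≋-trans (⊕-congˡ e₄) (≋-sym (⊕-assoc (single c A) (single c A) s″)))
         , e₃ )

  contract-principal : ∀ {k c A s} → (∀ t → Contractible k t) → (r : Rule c A) →
                       Premises k r (single c A ⊕ s) → DerivH (suc k) (single c A ⊕ s)
  contract-principal {k} {c} {A} {s} contract r above =
    infer r ≋-refl (All.map (λ {t} d → contract t s (DerivH-resp-≋ (≋-sym (⊕-assoc t t s)) d))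
                            (All-diagonal inverted))
    where
      inverted : All (λ t → All (λ t′ → DerivH k (t′ ⊕ t ⊕ s)) (premises r)) (premises r)
      inverted = All.map (λ {t} d → invert k r (t ⊕ s)
                                      (DerivH-resp-≋ (x∙yz≈y∙xz t (single c A) s) d))
                         above

  mutual
    contractible : ∀ n t → Contractible n t
    contractible n ([] ∣ [] ⇒ []) w d = d
    contractible n ((B ∷ S) ∣ G ⇒ D) =
      ⊕-contractible (contractible-single n boxes B) (contractible n (S ∣ G ⇒ D))
    contractible n ([] ∣ (B ∷ G) ⇒ D) =
      ⊕-contractible (contractible-single n antecedent B) (contractible n ([] ∣ G ⇒ D))
    contractible n ([] ∣ [] ⇒ (B ∷ D)) =
      ⊕-contractible (contractible-single n succedent B) (contractible n ([] ∣ [] ⇒ D))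

    contractible-single : ∀ n c A → Contractible n (single c A)
    contractible-single n c A w d with lastRule d
    ... | initial ini = fromInitial (Initial-contract c ini)
    ... | kn κ = fromKn (Kn-contract c (contractible-single _ antecedent) κ)
    ... | rule {c = c′} {A′} r s′ e above with locate-duplicate c c′ {A} {A′} e
    ...   | inj₁ (refl , refl , e′) =
      contract-principal (contractible _) r (Premises-resp-≋ e′ above)
    ...   | inj₂ (s″ , e₁ , e₂) =
      DerivH-resp-≋ (⊕-congˡ (≋-sym e₂))
        (replace-in-premises r (contractible-single _ c A) (Premises-resp-≋ e₁ above))

proposition4p10 : (m : ℕ) (n : ℕ) (Σs Γ Δ : List (Fml m)) (A : Fml m) (i : Fin m) →
    (DerivH n (Σs ∣ Γ ⇒ (Δ ++ (A ∷ A ∷ []))) → DerivH n (Σs ∣ Γ ⇒ (Δ ++ (A ∷ []))))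
    × (DerivH n (Σs ∣ (A ∷ A ∷ Γ) ⇒ Δ) → DerivH n (Σs ∣ (A ∷ Γ) ⇒ Δ))
    × (DerivH n ((Σs ++ (□ i A ∷ □ i A ∷ [])) ∣ Γ ⇒ Δ) → DerivH n ((Σs ++ (□ i A ∷ [])) ∣ Γ ⇒ Δ))
proposition4p10 m n Σs Γ Δ A i =
    (λ d → DerivH-resp-≋ ⟨ ↭-refl , ↭-refl , ++-comm (A ∷ []) Δ ⟩
             (contractible-single n succedent A w
               (DerivH-resp-≋ ⟨ ↭-refl , ↭-refl , ++-comm Δ (A ∷ A ∷ []) ⟩ d)))
  , contractible-single n antecedent A w
  , (λ d → DerivH-resp-≋ ⟨ ++-comm (□ i A ∷ []) Σs , ↭-refl , ↭-refl ⟩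
             (contractible-single n boxes (□ i A) w
               (DerivH-resp-≋ ⟨ ++-comm Σs (□ i A ∷ □ i A ∷ []) , ↭-refl , ↭-refl ⟩ d)))
  where
    w : TSeq m
    w = Σs ∣ Γ ⇒ Δ
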